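{- Let $f$ be the $n$-ary operation on $\mathbb{Z}_8$ given by $f=2x_1\cdots x_n\left(\sum_{i=1}^n a_ix_i^2+\sum_{i=1}^n b_ix_i+c\right)$ with $a_i,b_i\in\{0,1\}$, $c\in\{0,1,2,3\}$, and assume $a_i\ne0$ for some $i$. Then $2w_n\in C(f)$, where $w_n=x_1\cdots x_n(x_1^2+1)$.
   Context: For an operation $g$ on $\mathbb{Z}_8$, $C(g)$ denotes the clone on $\mathbb{Z}_8$ generated by $g$, the binary addition and all unary constant operations. -}

module Defs where

open import Data.Nat using (ℕ; zero; suc; _+_; _*_)
open import Data.Nat.DivMod using (_mod_)
open import Data.Fin using (Fin; toℕ) renaming (zero to Fzero)
open import Data.Vec.Functional using (foldr)
open import Data.Product using (Σ)
open import Relation.Binary.PropositionalEquality using (_≡_)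

ℤ₈ : Set
ℤ₈ = Fin 8

_+₈_ : ℤ₈ → ℤ₈ → ℤ₈
a +₈ b = (toℕ a + toℕ b) mod 8

Op : ℕ → Set
Op m = (Fin m → ℤ₈) → ℤ₈

data Term (k m : ℕ) : Set where
  var   : Fin m → Term k m
  const : ℤ₈ → Term k m
  add   : Term k m → Term k m → Term k m
  gapp  : (Fin k → Term k m) → Term k m

eval : ∀ {k m} → Op k → Term k m → Op m
eval g (var i)    x = x i
eval g (const c)  x = c
eval g (add s t)  x = eval g s x +₈ eval g t x
eval g (gapp ts)  x = g (λ j → eval g (ts j) x)

-- h ∈ C(g): h is a term operation of the algebra (ℤ₈; g, +, constants),
-- i.e. h lies in the clone generated by g, + and all unary constants.
_∈C_ : ∀ {m k} → Op m → Op k → Set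
h ∈C g = Σ (Term _ _) λ t → ∀ x → eval g t x ≡ h x

Σℕ : ∀ {n} → (Fin n → ℕ) → ℕ
Σℕ = foldr _+_ 0

Πℕ : ∀ {n} → (Fin n → ℕ) → ℕ
Πℕ = foldr _*_ 1

fOp : (n : ℕ) → (a b : Fin n → Fin 2) → (c : Fin 4) → Op n
fOp n a b c x =
  (2 * Πℕ (λ i → toℕ (x i))
     * (Σℕ (λ i → toℕ (a i) * toℕ (x i) * toℕ (x i))
        + Σℕ (λ i → toℕ (b i) * toℕ (x i))
        + toℕ c)) mod 8

-- 2wₙ where wₙ = x₁⋯xₙ (x₁² + 1), arity n (for n ≥ 1, written suc m).
twoW : (m : ℕ) → Op (suc m)
twoW m x =
  (2 * Πℕ (λ i → toℕ (x i))
     * (toℕ (x Fzero) * toℕ (x Fzero) + 1)) mod 8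

-- Fix i with aᵢ = 1. As a function of t = xᵢ alone, f is 2pt(t² + βt + r) mod 8, where β = bᵢ,
-- p is the product of the other arguments and r does not depend on t. Polarizing in xᵢ,
-- f(t + s) − f(t) − f(s) = 2pts(3(t + s) + 2β), eliminates r; since the other arguments of f may
-- be arbitrary terms, p can be made u·q or v·q with u = x₁, v = x₂, q = x₃⋯xₙ, and four such
-- polarizations combine to 2uvq(u² + 1) = 2wₙ. For n = 1 there is no product to exploit: instead
-- f(x + β) has no quadratic term mod 8, and multiples of x and 1 correct the rest.
{-# OPTIONS --safe #-}
module Submission where

open import Defs
open import Data.Nat using (ℕ; suc)
open import Data.Fin using (Fin; zero)
open import Data.Product using (∃)
open import Relation.Binary.PropositionalEquality using (_≢_)

open import Algebra.Bundles using (RawMonoid)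
open import Data.Nat using (_+_; _*_; _%_)
open import Data.Nat.DivMod using (_mod_; m%n<n; m<n⇒m%n≡m; %-distribˡ-+; %-distribˡ-*)
open import Data.Nat.Properties using (+-0-commutativeMonoid; *-1-commutativeMonoid)
open import Data.Nat.Tactic.RingSolver using (solve-∀)
open import Data.Fin using (toℕ) renaming (suc to fsuc)
open import Data.Fin.Properties using (all?; _≟_; toℕ-injective; toℕ-fromℕ<; toℕ<n)
open import Data.Product using (_,_)
open import Data.Vec.Functional using (_∷_; tail; insertAt; removeAt)
open import Data.Vec.Functional.Properties using (insertAt-lookup; insertAt-punchIn)
open import Function using (_∘_)
open import Relation.Nullary.Decidable using (from-yes)
open import Relation.Nullary.Negation using (contradiction)
open import Relation.Binary.PropositionalEquality
  using (_≡_; _≗_; refl; sym; trans; cong; cong₂; module ≡-Reasoning)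
import Algebra.Properties.CommutativeMonoid.Sum as CommutativeMonoidSum

open ≡-Reasoning
module Σ = CommutativeMonoidSum +-0-commutativeMonoid
module Π = CommutativeMonoidSum *-1-commutativeMonoid

[_] : ℕ → ℤ₈
[ m ] = m mod 8

infixl 21 _*₈_
_*₈_ : ℤ₈ → ℤ₈ → ℤ₈
x *₈ y = [ toℕ x * toℕ y ]

ℤ₈-+-rawMonoid : RawMonoid _ _
ℤ₈-+-rawMonoid = record { Carrier = ℤ₈ ; _≈_ = _≡_ ; _∙_ = _+₈_ ; ε = zero }

open import Algebra.Definitions.RawMonoid ℤ₈-+-rawMonoid using ()
  renaming (_×_ to infixr 22 _×₈_)

toℕ-[] : ∀ m → toℕ [ m ] ≡ m % 8
toℕ-[] m = toℕ-fromℕ< (m%n<n m 8)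

[]-cong-% : ∀ m n → m % 8 ≡ n % 8 → [ m ] ≡ [ n ]
[]-cong-% m n eq = toℕ-injective (trans (toℕ-[] m) (trans eq (sym (toℕ-[] n))))

[toℕ] : ∀ x → [ toℕ x ] ≡ x
[toℕ] x = toℕ-injective (trans (toℕ-[] (toℕ x)) (m<n⇒m%n≡m (toℕ<n x)))

[]-homo-+ : ∀ m n → [ m + n ] ≡ [ m ] +₈ [ n ]
[]-homo-+ m n = []-cong-% (m + n) (toℕ [ m ] + toℕ [ n ]) (begin
  (m + n) % 8                    ≡⟨ %-distribˡ-+ m n 8 ⟩
  (m % 8 + n % 8) % 8            ≡⟨ cong₂ (λ p q → (p + q) % 8) (toℕ-[] m) (toℕ-[] n) ⟨
  (toℕ [ m ] + toℕ [ n ]) % 8    ∎)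

[]-homo-* : ∀ m n → [ m * n ] ≡ [ m ] *₈ [ n ]
[]-homo-* m n = []-cong-% (m * n) (toℕ [ m ] * toℕ [ n ]) (begin
  (m * n) % 8                    ≡⟨ %-distribˡ-* m n 8 ⟩
  (m % 8 * (n % 8)) % 8          ≡⟨ cong₂ (λ p q → (p * q) % 8) (toℕ-[] m) (toℕ-[] n) ⟨
  (toℕ [ m ] * toℕ [ n ]) % 8    ∎)

[toℕ*] : ∀ x n → [ toℕ x * n ] ≡ x *₈ [ n ]
[toℕ*] x n = trans ([]-homo-* (toℕ x) n) (cong (_*₈ [ n ]) ([toℕ] x))

[2*[toℕ*]*] : ∀ t p s → [ 2 * (toℕ t * p) * s ] ≡ [ 2 ] *₈ (t *₈ [ p ]) *₈ [ s ]
[2*[toℕ*]*] t p s = begin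
  [ 2 * (toℕ t * p) * s ]              ≡⟨ []-homo-* (2 * (toℕ t * p)) s ⟩
  [ 2 * (toℕ t * p) ] *₈ [ s ]         ≡⟨ cong (_*₈ [ s ]) ([]-homo-* 2 (toℕ t * p)) ⟩
  [ 2 ] *₈ [ toℕ t * p ] *₈ [ s ]      ≡⟨ cong (λ z → [ 2 ] *₈ z *₈ [ s ]) ([toℕ*] t p) ⟩
  [ 2 ] *₈ (t *₈ [ p ]) *₈ [ s ]       ∎

prod : ∀ {n} → (Fin n → ℤ₈) → ℤ₈
prod zs = [ Πℕ (toℕ ∘ zs) ]

prod-cong : ∀ {n} {zs zs′ : Fin n → ℤ₈} → zs ≗ zs′ → prod zs ≡ prod zs′
prod-cong eq = cong [_] (Π.sum-cong-≗ (cong toℕ ∘ eq))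

prod-∷ : ∀ {n} z (zs : Fin n → ℤ₈) → prod (z ∷ zs) ≡ z *₈ prod zs
prod-∷ z zs = [toℕ*] z (Πℕ (toℕ ∘ zs))

cubic : (β r p t : ℤ₈) → ℤ₈
cubic β r p t = [ 2 ] *₈ (t *₈ p) *₈ ((t *₈ t +₈ β *₈ t) +₈ r)

-- 7 = -1 in ℤ₈
polarization : (ℤ₈ → ℤ₈) → ℤ₈ → ℤ₈ → ℤ₈
polarization g t s = g (t +₈ s) +₈ 7 ×₈ (g t +₈ g s)

Δcubic : (β p t s : ℤ₈) → ℤ₈
Δcubic β p t s = [ 2 ] *₈ (p *₈ (t *₈ s)) *₈ ([ 3 ] *₈ (t +₈ s) +₈ [ 2 ] *₈ β)

cubic-polarization : ∀ β r p t s → polarization (cubic β r p) t s ≡ Δcubic β p t s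
cubic-polarization = from-yes (all? λ β → all? λ r → all? λ p → all? λ t → all? λ s →
  polarization (cubic β r p) t s ≟ Δcubic β p t s)

twoWForm : (u p : ℤ₈) → ℤ₈
twoWForm u p = [ 2 ] *₈ (u *₈ p) *₈ (u *₈ u +₈ [ 1 ])

twoW-twoWForm : ∀ m x → twoW m x ≡ twoWForm (x zero) (prod (tail x))
twoW-twoWForm m x = trans ([2*[toℕ*]*] u (Πℕ (toℕ ∘ tail x)) (U * U + 1))
                          (cong (λ s → [ 2 ] *₈ (u *₈ prod (tail x)) *₈ s) ([]-homo-+ (U * U) 1))
  where
  u : ℤ₈
  u = x zero
  U : ℕ
  U = toℕ u

-- Expanding over ℤ, the left side is 2uvq(u² + 1) + 2q·u(u − 1)·v(v + 1) plus a multiple of 8.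
twoWForm-from-Δcubic : ∀ (b : Fin 2) u v q → let β = [ toℕ b ] in
  (7 ×₈ Δcubic β (v *₈ q) u [ 1 ] +₈ 7 ×₈ Δcubic β (u *₈ q) v u)
    +₈ (Δcubic β (u *₈ q) v [ 1 ] +₈ toℕ b ×₈ Δcubic β (v *₈ q) u [ 2 ])
    ≡ twoWForm u (v *₈ q)
twoWForm-from-Δcubic = from-yes (all? λ (b : Fin 2) → all? λ u → all? λ v → all? λ q → let β = [ toℕ b ] in
  (7 ×₈ Δcubic β (v *₈ q) u [ 1 ] +₈ 7 ×₈ Δcubic β (u *₈ q) v u)
    +₈ (Δcubic β (u *₈ q) v [ 1 ] +₈ toℕ b ×₈ Δcubic β (v *₈ q) u [ 2 ])
    ≟ twoWForm u (v *₈ q))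

-- The shift by β makes the x² coefficient 2·4β ≡ 0.
shifted-cubic : ∀ (b : Fin 2) (c : Fin 4) x → let β = [ toℕ b ]; B = toℕ b; C = toℕ c in
  cubic β [ C ] [ 1 ] (x +₈ β) +₈ ((2 + 6 * C + 6 * B) ×₈ x +₈ (B * (4 + 6 * C)) ×₈ [ 1 ])
    ≡ twoWForm x [ 1 ]
shifted-cubic = from-yes (all? λ (b : Fin 2) → all? λ (c : Fin 4) → all? λ x →
  let β = [ toℕ b ]; B = toℕ b; C = toℕ c in
  cubic β [ C ] [ 1 ] (x +₈ β) +₈ ((2 + 6 * C + 6 * B) ×₈ x +₈ (B * (4 + 6 * C)) ×₈ [ 1 ])
    ≟ twoWForm x [ 1 ])

infixr 22 _⊗_
_⊗_ : ∀ {k m} → ℕ → Term k m → Term k m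
0     ⊗ t = const zero
suc j ⊗ t = add t (j ⊗ t)

eval-⊗ : ∀ {k m} (g : Op k) j (t : Term k m) x → eval g (j ⊗ t) x ≡ j ×₈ eval g t x
eval-⊗ g 0       t x = refl
eval-⊗ g (suc j) t x = cong (eval g t x +₈_) (eval-⊗ g j t x)

module CubicIn {n} (a b : Fin (suc n) → Fin 2) (c : Fin 4) (i : Fin (suc n))
               (aᵢ≡1 : toℕ (a i) ≡ 1) where

  f : Op (suc n)
  f = fOp (suc n) a b c

  β : ℤ₈
  β = [ toℕ (b i) ]

  rest : (Fin n → ℤ₈) → ℤ₈
  rest zs = [ Σℕ (λ j → toℕ (removeAt a i j) * toℕ (zs j) * toℕ (zs j))
            + Σℕ (λ j → toℕ (removeAt b i j) * toℕ (zs j)) + toℕ c ]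

  rest-cong : ∀ {zs zs′} → zs ≗ zs′ → rest zs ≡ rest zs′
  rest-cong eq = cong [_] (cong₂ (λ SA SB → SA + SB + toℕ c)
    (Σ.sum-cong-≗ λ j → cong (λ z → toℕ (removeAt a i j) * toℕ z * toℕ z) (eq j))
    (Σ.sum-cong-≗ λ j → cong (λ z → toℕ (removeAt b i j) * toℕ z) (eq j)))

  f-cubic : ∀ y → f y ≡ cubic β (rest (removeAt y i)) (prod (removeAt y i)) (y i)
  f-cubic y = begin
    [ 2 * Πℕ Y * (Σℕ A + Σℕ B + C) ]
      ≡⟨ cong₂ (λ P S → [ 2 * P * S ]) (Π.sum-remove {i = i} Y)
               (cong₂ (λ SA SB → SA + SB + C) (Σ.sum-remove {i = i} A) (Σ.sum-remove {i = i} B)) ⟩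
    [ 2 * (T * P) * ((toℕ (a i) * T * T + RA) + (Bᵢ * T + RB) + C) ]
      ≡⟨ cong (λ Aᵢ → [ 2 * (T * P) * ((Aᵢ * T * T + RA) + (Bᵢ * T + RB) + C) ]) aᵢ≡1 ⟩
    [ 2 * (T * P) * ((1 * T * T + RA) + (Bᵢ * T + RB) + C) ]
      ≡⟨ cong (λ S → [ 2 * (T * P) * S ]) (regroup T Bᵢ RA RB C) ⟩
    [ 2 * (T * P) * ((T * T + Bᵢ * T) + R) ]
      ≡⟨ [2*[toℕ*]*] t P ((T * T + Bᵢ * T) + R) ⟩
    [ 2 ] *₈ (t *₈ [ P ]) *₈ [ (T * T + Bᵢ * T) + R ]
      ≡⟨ cong (λ s → [ 2 ] *₈ (t *₈ [ P ]) *₈ s)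
              (trans ([]-homo-+ (T * T + Bᵢ * T) R) (cong (_+₈ [ R ]) ([]-homo-+ (T * T) (Bᵢ * T)))) ⟩
    [ 2 ] *₈ (t *₈ [ P ]) *₈ ((t *₈ t +₈ [ Bᵢ * T ]) +₈ [ R ])
      ≡⟨ cong (λ bt → [ 2 ] *₈ (t *₈ [ P ]) *₈ ((t *₈ t +₈ bt) +₈ [ R ]))
              (trans ([]-homo-* Bᵢ T) (cong (β *₈_) ([toℕ] t))) ⟩
    cubic β (rest (removeAt y i)) (prod (removeAt y i)) t ∎
    where
    t : ℤ₈
    t = y i
    Y A B : Fin (suc n) → ℕ
    Y = toℕ ∘ y
    A j = toℕ (a j) * Y j * Y j
    B j = toℕ (b j) * Y j
    T Bᵢ C P RA RB R : ℕ
    T = toℕ t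
    Bᵢ = toℕ (b i)
    C = toℕ c
    P = Πℕ (removeAt Y i)
    RA = Σℕ (removeAt A i)
    RB = Σℕ (removeAt B i)
    R = RA + RB + C
    regroup : ∀ T B RA RB C → (1 * T * T + RA) + (B * T + RB) + C ≡ (T * T + B * T) + (RA + RB + C)
    regroup = solve-∀

  eval-insertAt : ∀ {m} zs (t : Term (suc n) m) x →
    eval f (gapp (insertAt zs i t)) x
      ≡ cubic β (rest (λ j → eval f (zs j) x)) (prod (λ j → eval f (zs j) x)) (eval f t x)
  eval-insertAt zs t x = begin
    f y                                                        ≡⟨ f-cubic y ⟩
    cubic β (rest (removeAt y i)) (prod (removeAt y i)) (y i)  ≡⟨ cong₂ (λ r p → cubic β r p (y i))
                                                                        (rest-cong others) (prod-cong others) ⟩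
    cubic β (rest ⟦zs⟧) (prod ⟦zs⟧) (y i)                      ≡⟨ cong (λ s → cubic β (rest ⟦zs⟧) (prod ⟦zs⟧) (eval f s x))
                                                                       (insertAt-lookup zs i t) ⟩
    cubic β (rest ⟦zs⟧) (prod ⟦zs⟧) (eval f t x)               ∎
    where
    y : Fin (suc n) → ℤ₈
    y j = eval f (insertAt zs i t j) x
    ⟦zs⟧ : Fin n → ℤ₈
    ⟦zs⟧ j = eval f (zs j) x
    others : removeAt y i ≗ ⟦zs⟧
    others j = cong (λ s → eval f s x) (insertAt-punchIn zs i t j)

  polarizationTerm : ∀ {m} → (Fin n → Term (suc n) m) → Term (suc n) m → Term (suc n) m → Term (suc n) m
  polarizationTerm zs t s = add (gapp (insertAt zs i (add t s))) (7 ⊗ add (gapp (insertAt zs i t)) (gapp (insertAt zs i s)))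

  eval-polarizationTerm : ∀ {m} zs (t s : Term (suc n) m) x →
    eval f (polarizationTerm zs t s) x ≡ Δcubic β (prod (λ j → eval f (zs j) x)) (eval f t x) (eval f s x)
  eval-polarizationTerm zs t s x = begin
    eval f (polarizationTerm zs t s) x
      ≡⟨ cong₂ _+₈_ (eval-insertAt zs (add t s) x)
                    (trans (eval-⊗ f 7 (add (gapp (insertAt zs i t)) (gapp (insertAt zs i s))) x)
                           (cong (7 ×₈_) (cong₂ _+₈_ (eval-insertAt zs t x) (eval-insertAt zs s x)))) ⟩
    polarization (cubic β (rest ⟦zs⟧) (prod ⟦zs⟧)) (eval f t x) (eval f s x)
      ≡⟨ cubic-polarization β (rest ⟦zs⟧) (prod ⟦zs⟧) (eval f t x) (eval f s x) ⟩
    Δcubic β (prod ⟦zs⟧) (eval f t x) (eval f s x) ∎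
    where
    ⟦zs⟧ : Fin n → ℤ₈
    ⟦zs⟧ j = eval f (zs j) x

twoW∈C-unary : (a b : Fin 1 → Fin 2) (c : Fin 4) → toℕ (a zero) ≡ 1 → twoW 0 ∈C fOp 1 a b c
twoW∈C-unary a b c a₀≡1 = term , λ x → trans (value x) (sym (twoW-twoWForm 0 x))
  where
  open CubicIn a b c zero a₀≡1
  B C : ℕ
  B = toℕ (b zero)
  C = toℕ c
  u term : Term 1 1
  u = var zero
  term = add (gapp (λ _ → add u (const β))) (add ((2 + 6 * C + 6 * B) ⊗ u) ((B * (4 + 6 * C)) ⊗ const [ 1 ]))
  value : ∀ x → eval f term x ≡ twoWForm (x zero) [ 1 ]
  value x = trans
    (cong₂ _+₈_ (f-cubic (λ _ → x zero +₈ β))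
                (cong₂ _+₈_ (eval-⊗ f (2 + 6 * C + 6 * B) u x) (eval-⊗ f (B * (4 + 6 * C)) (const [ 1 ]) x)))
    (shifted-cubic (b zero) c (x zero))

twoW∈C-polyadic : ∀ {m} (a b : Fin (suc (suc m)) → Fin 2) (c : Fin 4) i → toℕ (a i) ≡ 1 →
  twoW (suc m) ∈C fOp (suc (suc m)) a b c
twoW∈C-polyadic {m} a b c i aᵢ≡1 = term , λ x → trans (value x) (sym (twoW-twoWForm (suc m) x))
  where
  open CubicIn a b c i aᵢ≡1
  T : Set
  T = Term (suc (suc m)) (suc (suc m))
  u v one two term : T
  u = var zero
  v = var (fsuc zero)
  one = const [ 1 ]
  two = const [ 2 ]
  qs : Fin m → T
  qs = var ∘ fsuc ∘ fsuc
  Δ : T → T → T → T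
  Δ z = polarizationTerm (z ∷ qs)
  term = add (add (7 ⊗ Δ v u one) (7 ⊗ Δ u v u)) (add (Δ u v one) (toℕ (b i) ⊗ Δ v u two))
  module _ (x : Fin (suc (suc m)) → ℤ₈) where
    q : ℤ₈
    q = prod (tail (tail x))
    eval-Δ : ∀ z t s → eval f (Δ z t s) x ≡ Δcubic β (eval f z x *₈ q) (eval f t x) (eval f s x)
    eval-Δ z t s = trans (eval-polarizationTerm (z ∷ qs) t s x)
                         (cong (λ p → Δcubic β p (eval f t x) (eval f s x)) (prod-∷ (eval f z x) (tail (tail x))))
    eval-⊗Δ : ∀ k z t s → eval f (k ⊗ Δ z t s) x ≡ k ×₈ Δcubic β (eval f z x *₈ q) (eval f t x) (eval f s x)
    eval-⊗Δ k z t s = trans (eval-⊗ f k (Δ z t s) x) (cong (k ×₈_) (eval-Δ z t s))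
    value : eval f term x ≡ twoWForm (x zero) (prod (tail x))
    value = begin
      eval f term x
        ≡⟨ cong₂ _+₈_ (cong₂ _+₈_ (eval-⊗Δ 7 v u one) (eval-⊗Δ 7 u v u))
                      (cong₂ _+₈_ (eval-Δ u v one) (eval-⊗Δ (toℕ (b i)) v u two)) ⟩
      (7 ×₈ Δcubic β (x₁ *₈ q) x₀ [ 1 ] +₈ 7 ×₈ Δcubic β (x₀ *₈ q) x₁ x₀)
        +₈ (Δcubic β (x₀ *₈ q) x₁ [ 1 ] +₈ toℕ (b i) ×₈ Δcubic β (x₁ *₈ q) x₀ [ 2 ])
        ≡⟨ twoWForm-from-Δcubic (b i) x₀ x₁ q ⟩
      twoWForm x₀ (x₁ *₈ q)
        ≡⟨ cong (twoWForm x₀) (prod-∷ x₁ (tail (tail x))) ⟨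
      twoWForm x₀ (prod (tail x)) ∎
      where
      x₀ x₁ : ℤ₈
      x₀ = x zero
      x₁ = x (fsuc zero)

≢zero⇒toℕ≡1 : {z : Fin 2} → z ≢ zero → toℕ z ≡ 1
≢zero⇒toℕ≡1 {zero}      z≢0 = contradiction refl z≢0
≢zero⇒toℕ≡1 {fsuc zero} _   = refl

lemma4p7 : (n : ℕ) (a b : Fin (suc n) → Fin 2) (c : Fin 4) →
    ∃ (λ i → a i ≢ zero) →
    twoW n ∈C fOp (suc n) a b c
lemma4p7 0       a b c (zero , a₀≢0) = twoW∈C-unary a b c (≢zero⇒toℕ≡1 a₀≢0)
lemma4p7 (suc m) a b c (i , aᵢ≢0)    = twoW∈C-polyadic a b c i (≢zero⇒toℕ≡1 aᵢ≢0)
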